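{- For $n\ge 8$, $n-2\le c_1(n,P_3)\le n+4$, where $P_3$ is the $3$-graph with vertex set $\{v_1,\dots,v_7\}$ and edges $\{v_1,v_2,v_3\},\{v_3,v_4,v_5\},\{v_5,v_6,v_7\}$.
   Context: For a $3$-graph $G$, $\delta_1(G)$ is the minimum number of edges containing a vertex; $G$ has an $F$-covering if every vertex lies in a copy of $F$; $c_1(n,F)$ is the maximum of $\delta_1(G)$ over $n$-vertex $3$-graphs $G$ with no $F$-covering. -}

module Defs where

open import Data.Nat using (ℕ; _≤_; _∸_; _+_)
open import Data.Fin using (Fin)
open import Data.Fin.Subset using (Subset; ⁅_⁆; _∪_; ∣_∣) renaming (_∈_ to _∈ₛ_)
open import Data.Fin.Subset.Properties using (_∈?_)
open import Data.List using (List; length; filter)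
open import Data.List.Membership.Propositional using (_∈_)
open import Data.List.Relation.Unary.All using (All)
open import Data.List.Relation.Unary.Unique.Propositional using (Unique)
open import Data.Product using (Σ; ∃; _×_)
open import Relation.Binary.PropositionalEquality using (_≡_)
open import Function.Definitions using (Injective)

record 3-Graph (n : ℕ) : Set where
  field
    edges     : List (Subset n)
    unique    : Unique edges
    size3     : All (λ e → ∣ e ∣ ≡ 3) edges
open 3-Graph public

triple : ∀ {n} → Fin n → Fin n → Fin n → Subset n
triple a b c = ⁅ a ⁆ ∪ (⁅ b ⁆ ∪ ⁅ c ⁆)

deg : ∀ {n} → 3-Graph n → Fin n → ℕ
deg G v = length (filter (v ∈?_) (edges G))

MinDeg≥ : ∀ {n} → 3-Graph n → ℕ → Set
MinDeg≥ G d = ∀ v → d ≤ deg G v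

-- The 3-graph P₃ on {v₁,…,v₇} (indices 0..6) with edges
-- {v₁,v₂,v₃}, {v₃,v₄,v₅}, {v₅,v₆,v₇}.
-- A copy of P₃ in G: an injective map φ : Fin 7 → Fin n sending every
-- edge of P₃ to an edge of G.
IsP₃Copy : ∀ {n} → 3-Graph n → (Fin 7 → Fin n) → Set
IsP₃Copy G φ =
  Injective _≡_ _≡_ φ ×
  (triple (φ (# 0)) (φ (# 1)) (φ (# 2)) ∈ edges G) ×
  (triple (φ (# 2)) (φ (# 3)) (φ (# 4)) ∈ edges G) ×
  (triple (φ (# 4)) (φ (# 5)) (φ (# 6)) ∈ edges G)
  where open import Data.Fin using (#_)

HasP₃Covering : ∀ {n} → 3-Graph n → Set
HasP₃Covering {n} G =
  ∀ (v : Fin n) → Σ (Fin 7 → Fin n) λ φ → IsP₃Copy G φ × (∃ λ i → φ i ≡ v)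

module Submission where

-- Lower bound: in the star (all triples through one vertex) any two edges meet, so it contains
-- no copy of P₃ at all, while every vertex lies in at least n − 2 edges.
--
-- Upper bound: suppose δ₁(G) ≥ n + 5 and x lies in no copy of P₃.  Two vertices share at most
-- n − 2 edges, so for u ≠ v at least 7 edges contain v but not u.  If x has codegree at least 5
-- with some b, then for every edge {b, c, d} avoiding x, each edge at d avoiding x and b contains
-- c, since otherwise an edge {x, a, b} completes a copy (x a b)(b c d)(d p q).  Counting with this
-- shows that b and d have at most one such common neighbour c, then that x has codegree at least
-- 5 with d as well, and finally that some edge at b avoids x, a, c, d for an edge {x, a, d}: a copy
-- (x a d)(d c b)(b p q).  If instead every codegree of x is at most 4, take an edge {x, c, d}: at
-- least six edges contain x but neither c nor d, and each must meet all of the (at least three)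
-- edges containing d but neither x nor c; two such edges at d either share a second vertex or
-- not, and both cases leave room for at most five edges at x.

open import Defs
open import Data.Nat using (ℕ; zero; suc; _≤_; _<_; _+_; _∸_; z≤n; s≤s; s≤s⁻¹; _<?_; _≤?_)
import Data.Nat as ℕ
open import Data.Nat.Properties
  using ( ≤-refl; ≤-reflexive; ≤-trans; ≤-antisym; <-≤-trans; <⇒≱; n≮n; ≮⇒≥; ≰⇒>; m≤n⇒m≤1+n; n≤1+n; m≤n+m
        ; +-comm; +-assoc; +-suc; +-monoˡ-≤; +-monoʳ-≤; +-mono-≤; +-cancelˡ-≤; +-cancelʳ-≤; +-cancelʳ-≡ )
open import Data.Bool.Properties using () renaming (_≟_ to _≟ᵇ_)
open import Data.Fin using (Fin; zero; suc; #_)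
open import Data.Fin.Properties using (_≟_; any?; sequence)
open import Data.Fin.Subset using (Subset; ⁅_⁆; _∪_; ⋃; ∣_∣; inside; outside) renaming (_∈_ to _∈ₛ_; _∉_ to _∉ₛ_)
open import Data.Fin.Subset.Properties
  using (_∈?_; ∣⊥∣≡0; ∣⁅x⁆∣≡1; p⊆q⇒∣p∣≤∣q∣; x∈p⇒∣p-x∣<∣p∣; x∈p∧x≢y⇒x∈p-y; x∈p∪q⁺; x∈p∪q⁻; x∈⁅x⁆; x∈⁅y⁆⇒x≡y; ⊆-antisym)
open import Data.Vec using (lookup; []; _∷_)
open import Data.Vec.Properties using (≡-dec)
open import Data.Vec.Relation.Unary.All using ([]; _∷_)
open import Data.Vec.Relation.Unary.AllPairs using ([]; _∷_)
import Data.Vec.Relation.Unary.Unique.Propositional as Vec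
open import Data.Vec.Relation.Unary.Unique.Propositional.Properties using (lookup-injective)
open import Data.List using (List; []; _∷_; length; filter; map; allFin; _++_)
open import Data.List.Properties using (filter-notAll; filter-≐; filter-some; length-map; length-tabulate)
open import Data.List.Membership.Propositional using (_∈_; _∉_; find)
open import Data.List.Membership.Propositional.Properties using (∈-allFin; ∈-filter⁺; ∈-filter⁻; ∈-map⁺; ∈-map⁻; ∈-++⁺ˡ; ∈-++⁺ʳ)
open import Data.List.Relation.Unary.Any using (Any; here; there)
import Data.List.Relation.Unary.Any as Any
open import Data.List.Relation.Unary.All using (All; []; _∷_; all?)
import Data.List.Relation.Unary.All as All
open import Data.List.Relation.Unary.All.Properties using (¬Any⇒All¬)
open import Data.List.Relation.Unary.AllPairs using ([]; _∷_)
open import Data.List.Relation.Unary.Unique.Propositional using (Unique)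
open import Data.List.Relation.Unary.Unique.Propositional.Properties using (allFin⁺; filter⁺; map⁺; ++⁺)
open import Data.Product using (Σ; ∃; ∃₂; _×_; _,_; proj₁; proj₂)
open import Data.Sum using (_⊎_; inj₁; inj₂)
open import Data.Empty using (⊥; ⊥-elim)
open import Effect.Monad using (RawMonad)
open import Function using (_∘_; id)
open import Function.Definitions using (Injective)
open import Relation.Nullary using (¬_; Dec; yes; no; ¬?)
open import Relation.Nullary.Decidable using (_×-dec_; decidable-stable)
open import Relation.Nullary.Negation using (¬¬-Monad; contradiction)
open import Relation.Unary using (Decidable)
open import Relation.Unary.Properties using (∁?)
open import Relation.Binary.Definitions using (DecidableEquality)
open import Relation.Binary.PropositionalEquality using (_≡_; _≢_; refl; sym; trans; cong; subst; ≢-sym)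
open Data.Nat.Properties.≤-Reasoning

module _ {A : Set} {P : A → Set} (P? : Decidable P) where

  filter-some⁻ : ∀ xs → 0 < length (filter P? xs) → Any P xs
  filter-some⁻ (x ∷ xs) pos with P? x
  ... | yes px = here px
  ... | no _   = there (filter-some⁻ xs pos)

  length-filter+∁ : ∀ xs → length (filter P? xs) + length (filter (∁? P?) xs) ≡ length xs
  length-filter+∁ []       = refl
  length-filter+∁ (x ∷ xs) with P? x
  ... | yes _ = cong suc (length-filter+∁ xs)
  ... | no _  = trans (+-suc _ _) (cong suc (length-filter+∁ xs))

  module _ {Q : A → Set} (Q? : Decidable Q) where

    length-filter-mono : ∀ xs → (∀ {x} → x ∈ xs → P x → Q x) → length (filter P? xs) ≤ length (filter Q? xs)
    length-filter-mono []       P⊆Q = z≤n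
    length-filter-mono (x ∷ xs) P⊆Q with P? x | Q? x
    ... | yes _  | yes _  = s≤s (length-filter-mono xs (P⊆Q ∘ there))
    ... | yes px | no ¬qx = contradiction (P⊆Q (here refl) px) ¬qx
    ... | no _   | yes _  = m≤n⇒m≤1+n (length-filter-mono xs (P⊆Q ∘ there))
    ... | no _   | no _   = length-filter-mono xs (P⊆Q ∘ there)

    module _ {R : A → Set} (R? : Decidable R) where

      length-filter-⊎ : (∀ {x} → P x → Q x ⊎ R x) → (∀ {x} → Q x → P x) → (∀ {x} → R x → P x) →
                        (∀ {x} → Q x → ¬ R x) →
                        ∀ xs → length (filter P? xs) ≡ length (filter Q? xs) + length (filter R? xs)
      length-filter-⊎ split Q⊆P R⊆P disj [] = refl
      length-filter-⊎ split Q⊆P R⊆P disj (x ∷ xs) with P? x | Q? x | R? x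
      ... | _      | yes qx | yes rx = contradiction rx (disj qx)
      ... | yes _  | yes _  | no _   = cong suc (length-filter-⊎ split Q⊆P R⊆P disj xs)
      ... | yes _  | no _   | yes _  = trans (cong suc (length-filter-⊎ split Q⊆P R⊆P disj xs)) (sym (+-suc _ _))
      ... | yes px | no ¬qx | no ¬rx = contradiction (split px) λ { (inj₁ qx) → ¬qx qx ; (inj₂ rx) → ¬rx rx }
      ... | no ¬px | yes qx | no _   = contradiction (Q⊆P qx) ¬px
      ... | no ¬px | no _   | yes rx = contradiction (R⊆P rx) ¬px
      ... | no _   | no _   | no _   = length-filter-⊎ split Q⊆P R⊆P disj xs

length-≤-of-injection : ∀ {A B : Set} → DecidableEquality B → ∀ {xs : List A} {ys : List B} (f : A → B) → Unique xs →
                        (∀ {x} → x ∈ xs → f x ∈ ys) → (∀ {x y} → x ∈ xs → y ∈ xs → f x ≡ f y → x ≡ y) →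
                        length xs ≤ length ys
length-≤-of-injection _≟_ {[]}     f _            _    _   = z≤n
length-≤-of-injection _≟_ {x ∷ xs} {ys} f (x∉xs ∷ xs!) into inj =
  ≤-trans (s≤s (length-≤-of-injection _≟_ f xs! into′ (λ y∈ z∈ → inj (there y∈) (there z∈))))
          (filter-notAll ≢fx? ys (Any.map (λ fx≡y y≢fx → y≢fx (sym fx≡y)) (into (here refl))))
  where
  ≢fx? : Decidable (_≢ f x)
  ≢fx? y = ¬? (y ≟ f x)
  into′ : ∀ {z} → z ∈ xs → f z ∈ filter ≢fx? ys
  into′ z∈ = ∈-filter⁺ ≢fx? (into (there z∈)) (λ fz≡fx → All.lookup x∉xs z∈ (inj (here refl) (there z∈) (sym fz≡fx)))

m<m+n⇒0<n : ∀ m {n} → m < m + n → 0 < n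
m<m+n⇒0<n zero    m<m+n       = m<m+n
m<m+n⇒0<n (suc m) (s≤s m<m+n) = m<m+n⇒0<n m m<m+n

≤-cancel-boundˡ : ∀ k {m a b} → k + m ≤ a + b → a ≤ k → m ≤ b
≤-cancel-boundˡ k {m} {a} {b} k+m≤a+b a≤k = +-cancelˡ-≤ k m b (≤-trans k+m≤a+b (+-monoˡ-≤ b a≤k))

≤-cancel-boundʳ : ∀ k {m a b} → m + k ≤ a + b → b ≤ k → m ≤ a
≤-cancel-boundʳ k {m} {a} {b} m+k≤a+b b≤k = +-cancelʳ-≤ k m a (≤-trans m+k≤a+b (+-monoʳ-≤ a b≤k))

∣p∪q∣≤∣p∣+∣q∣ : ∀ {n} (p q : Subset n) → ∣ p ∪ q ∣ ≤ ∣ p ∣ + ∣ q ∣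
∣p∪q∣≤∣p∣+∣q∣ []            []            = z≤n
∣p∪q∣≤∣p∣+∣q∣ (inside ∷ p)  (inside ∷ q)  = s≤s (≤-trans (∣p∪q∣≤∣p∣+∣q∣ p q) (+-monoʳ-≤ ∣ p ∣ (n≤1+n _)))
∣p∪q∣≤∣p∣+∣q∣ (inside ∷ p)  (outside ∷ q) = s≤s (∣p∪q∣≤∣p∣+∣q∣ p q)
∣p∪q∣≤∣p∣+∣q∣ (outside ∷ p) (inside ∷ q)  = subst (suc ∣ p ∪ q ∣ ≤_) (sym (+-suc ∣ p ∣ ∣ q ∣)) (s≤s (∣p∪q∣≤∣p∣+∣q∣ p q))
∣p∪q∣≤∣p∣+∣q∣ (outside ∷ p) (outside ∷ q) = ∣p∪q∣≤∣p∣+∣q∣ p q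

module _ {n : ℕ} where

  open import Data.List.Membership.DecPropositional (_≟_ {n}) using () renaming (_∈?_ to _∈ₗ?_)

  length≤∣p∣ : ∀ {p : Subset n} {xs} → Unique xs → (∀ {x} → x ∈ xs → x ∈ₛ p) → length xs ≤ ∣ p ∣
  length≤∣p∣ {p} {[]}     _            _    = z≤n
  length≤∣p∣ {p} {x ∷ xs} (x∉xs ∷ xs!) xs⊆p =
    <-≤-trans (s≤s (length≤∣p∣ xs! λ y∈ → x∈p∧x≢y⇒x∈p-y (xs⊆p (there y∈)) (λ y≡x → All.lookup x∉xs y∈ (sym y≡x))))
              (x∈p⇒∣p-x∣<∣p∣ (xs⊆p (here refl)))

  ∣p∣≤length : ∀ {p : Subset n} xs → (∀ {x} → x ∈ₛ p → x ∈ xs) → ∣ p ∣ ≤ length xs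
  ∣p∣≤length {p} xs p⊆xs = ≤-trans (p⊆q⇒∣p∣≤∣q∣ (∈-⋃⁅⁆ xs ∘ p⊆xs)) (∣⋃⁅⁆∣≤length xs)
    where
    ∈-⋃⁅⁆ : ∀ {x} ys → x ∈ ys → x ∈ₛ ⋃ (map ⁅_⁆ ys)
    ∈-⋃⁅⁆ (y ∷ ys) (here refl) = x∈p∪q⁺ (inj₁ (x∈⁅x⁆ y))
    ∈-⋃⁅⁆ (y ∷ ys) (there x∈)  = x∈p∪q⁺ (inj₂ (∈-⋃⁅⁆ ys x∈))
    ∣⋃⁅⁆∣≤length : ∀ ys → ∣ ⋃ (map ⁅_⁆ ys) ∣ ≤ length ys
    ∣⋃⁅⁆∣≤length []       = ≤-reflexive (∣⊥∣≡0 n)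
    ∣⋃⁅⁆∣≤length (y ∷ ys) = ≤-trans (∣p∪q∣≤∣p∣+∣q∣ ⁅ y ⁆ _)
      (subst (_≤ suc (length ys)) (sym (cong (_+ _) (∣⁅x⁆∣≡1 y))) (s≤s (∣⋃⁅⁆∣≤length ys)))

  ∃-∉ : ∀ {p : Subset n} xs → length xs < ∣ p ∣ → ∃ λ z → z ∈ₛ p × z ∉ xs
  ∃-∉ {p} xs xs<∣p∣ with any? (λ z → z ∈? p ×-dec ¬? (z ∈ₗ? xs))
  ... | yes z∈p∖xs = z∈p∖xs
  ... | no ¬z∈p∖xs = contradiction (∣p∣≤length xs p⊆xs) (<⇒≱ xs<∣p∣)
    where
    p⊆xs : ∀ {z} → z ∈ₛ p → z ∈ xs
    p⊆xs {z} z∈p = decidable-stable (z ∈ₗ? xs) (λ z∉xs → ¬z∈p∖xs (z , z∈p , z∉xs))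

  ∣p∣≤length⇒⊆ : ∀ {p : Subset n} {xs} → Unique xs → (∀ {x} → x ∈ xs → x ∈ₛ p) → ∣ p ∣ ≤ length xs →
                 ∀ {z} → z ∈ₛ p → z ∈ xs
  ∣p∣≤length⇒⊆ {p} {xs} xs! xs⊆p ∣p∣≤ {z} z∈p with z ∈ₗ? xs
  ... | yes z∈xs = z∈xs
  ... | no z∉xs  = contradiction (≤-trans (length≤∣p∣ (¬Any⇒All¬ xs z∉xs ∷ xs!) z∷xs⊆p) ∣p∣≤) (n≮n _)
    where
    z∷xs⊆p : ∀ {x} → x ∈ z ∷ xs → x ∈ₛ p
    z∷xs⊆p (here refl) = z∈p
    z∷xs⊆p (there x∈)  = xs⊆p x∈

  ∈∧∉⇒≢ : ∀ {p : Subset n} {z w} → z ∈ₛ p → w ∉ₛ p → z ≢ w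
  ∈∧∉⇒≢ {p} z∈p w∉p z≡w = w∉p (subst (_∈ₛ p) z≡w z∈p)

  ∉∧∈⇒≢ : ∀ {p : Subset n} {w z} → w ∉ₛ p → z ∈ₛ p → w ≢ z
  ∉∧∈⇒≢ w∉p z∈p w≡z = ∈∧∉⇒≢ z∈p w∉p (sym w≡z)

  ∈-triple⁻ : ∀ {a b c w : Fin n} → w ∈ₛ triple a b c → w ∈ a ∷ b ∷ c ∷ []
  ∈-triple⁻ {a} {b} {c} w∈ with x∈p∪q⁻ ⁅ a ⁆ _ w∈
  ... | inj₁ w∈a = here (x∈⁅y⁆⇒x≡y a w∈a)
  ... | inj₂ w∈bc with x∈p∪q⁻ ⁅ b ⁆ ⁅ c ⁆ w∈bc
  ...   | inj₁ w∈b = there (here (x∈⁅y⁆⇒x≡y b w∈b))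
  ...   | inj₂ w∈c = there (there (here (x∈⁅y⁆⇒x≡y c w∈c)))

  ∈-triple⁺ : ∀ {a b c w : Fin n} → w ∈ a ∷ b ∷ c ∷ [] → w ∈ₛ triple a b c
  ∈-triple⁺ (here refl)                 = x∈p∪q⁺ (inj₁ (x∈⁅x⁆ _))
  ∈-triple⁺ (there (here refl))         = x∈p∪q⁺ (inj₂ (x∈p∪q⁺ (inj₁ (x∈⁅x⁆ _))))
  ∈-triple⁺ (there (there (here refl))) = x∈p∪q⁺ (inj₂ (x∈p∪q⁺ (inj₂ (x∈⁅x⁆ _))))

  ∣triple∣≡3 : ∀ {a b c : Fin n} → a ≢ b → a ≢ c → b ≢ c → ∣ triple a b c ∣ ≡ 3
  ∣triple∣≡3 {a} {b} {c} a≢b a≢c b≢c =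
    ≤-antisym (∣p∣≤length _ (∈-triple⁻ {a} {b} {c})) (length≤∣p∣ ((a≢b ∷ a≢c ∷ []) ∷ (b≢c ∷ []) ∷ [] ∷ []) ∈-triple⁺)

  ∣p∣≡3⇒≡triple : ∀ {p : Subset n} {a b c} → ∣ p ∣ ≡ 3 → a ≢ b → a ≢ c → b ≢ c →
                  a ∈ₛ p → b ∈ₛ p → c ∈ₛ p → p ≡ triple a b c
  ∣p∣≡3⇒≡triple ∣p∣≡3 a≢b a≢c b≢c a∈ b∈ c∈ =
    ⊆-antisym (∈-triple⁺ ∘ ∣p∣≤length⇒⊆ ((a≢b ∷ a≢c ∷ []) ∷ (b≢c ∷ []) ∷ [] ∷ []) abc⊆p (≤-reflexive ∣p∣≡3))
              (abc⊆p ∘ ∈-triple⁻)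
    where
    abc⊆p : ∀ {x} → x ∈ _ ∷ _ ∷ _ ∷ [] → x ∈ₛ _
    abc⊆p (here refl)                 = a∈
    abc⊆p (there (here refl))         = b∈
    abc⊆p (there (there (here refl))) = c∈

  -- Opaque so that xs can be recovered from a goal mentioning allFinExcept xs.
  opaque
    allFinExcept : List (Fin n) → List (Fin n)
    allFinExcept xs = filter (∁? (_∈ₗ? xs)) (allFin n)

  opaque
    unfolding allFinExcept

    ∈-allFinExcept⁺ : ∀ {xs z} → z ∉ xs → z ∈ allFinExcept xs
    ∈-allFinExcept⁺ {xs} z∉xs = ∈-filter⁺ (∁? (_∈ₗ? xs)) {xs = allFin n} (∈-allFin _) z∉xs

    ∈-allFinExcept⁻ : ∀ {xs z} → z ∈ allFinExcept xs → z ∉ xs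
    ∈-allFinExcept⁻ {xs} = proj₂ ∘ ∈-filter⁻ (∁? (_∈ₗ? xs)) {xs = allFin n}

    allFinExcept-unique : ∀ xs → Unique (allFinExcept xs)
    allFinExcept-unique xs = filter⁺ (∁? (_∈ₗ? xs)) (allFin⁺ n)

    length-allFinExcept : ∀ {xs} → Unique xs → length (allFinExcept xs) + length xs ≡ n
    length-allFinExcept {xs} xs! = begin-equality
      length (allFinExcept xs) + length xs                       ≡⟨ cong (length (allFinExcept xs) +_) xs≡∈xs ⟩
      length (allFinExcept xs) + length (filter ∈xs? (allFin n)) ≡⟨ length-filter+∁ (∁? (_∈ₗ? xs)) (allFin n) ⟩
      length (allFin n)                                          ≡⟨ length-tabulate id ⟩
      n                                                          ∎
      where
      ∈xs? : Decidable (λ z → ¬ ¬ (z ∈ xs))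
      ∈xs? = ∁? (∁? (_∈ₗ? xs))
      xs≡∈xs : length xs ≡ length (filter ∈xs? (allFin n))
      xs≡∈xs = ≤-antisym
        (length-≤-of-injection _≟_ id xs! (λ x∈ → ∈-filter⁺ ∈xs? {xs = allFin n} (∈-allFin _) (λ x∉ → x∉ x∈)) (λ _ _ → id))
        (length-≤-of-injection _≟_ id (filter⁺ ∈xs? {xs = allFin n} (allFin⁺ n))
          (λ x∈ → decidable-stable (_ ∈ₗ? xs) (proj₂ (∈-filter⁻ ∈xs? {xs = allFin n} x∈))) (λ _ _ → id))

-- Edge counts in a 3-graph

module EdgeCounting {n : ℕ} (G : 3-Graph n) where

  Through : List (Fin n) → List (Fin n) → Subset n → Set
  Through S F e = All (_∈ₛ e) S × All (_∉ₛ e) F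

  through? : ∀ S F → Decidable (Through S F)
  through? S F e = all? (_∈? e) S ×-dec all? (λ w → ¬? (w ∈? e)) F

  opaque
    #⟨_∖_⟩ : List (Fin n) → List (Fin n) → ℕ
    #⟨ S ∖ F ⟩ = length (filter (through? S F) (edges G))

  Edge⟨_∖_⟩ : List (Fin n) → List (Fin n) → Set
  Edge⟨ S ∖ F ⟩ = ∃ λ e → e ∈ edges G × Through S F e

  ∣edge∣≡3 : ∀ {e} → e ∈ edges G → ∣ e ∣ ≡ 3
  ∣edge∣≡3 = All.lookup (size3 G)

  edge≡triple : ∀ {e a b c} → e ∈ edges G → a ≢ b → a ≢ c → b ≢ c → a ∈ₛ e → b ∈ₛ e → c ∈ₛ e → e ≡ triple a b c
  edge≡triple e∈ = ∣p∣≡3⇒≡triple (∣edge∣≡3 e∈)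

  ¬four-in-edge : ∀ {e a b c d} → e ∈ edges G → Unique (a ∷ b ∷ c ∷ d ∷ []) → All (_∈ₛ e) (a ∷ b ∷ c ∷ d ∷ []) → ⊥
  ¬four-in-edge e∈ distinct abcd∈e =
    contradiction (subst (4 ≤_) (∣edge∣≡3 e∈) (length≤∣p∣ distinct (All.lookup abcd∈e))) λ { (s≤s (s≤s (s≤s ()))) }

  other-vertex : ∀ {e} → e ∈ edges G → ∀ a b → ∃ λ z → z ∈ₛ e × z ≢ a × z ≢ b
  other-vertex e∈ a b with ∃-∉ (a ∷ b ∷ []) (≤-reflexive (sym (∣edge∣≡3 e∈)))
  ... | z , z∈ , z∉ab = z , z∈ , z∉ab ∘ here , z∉ab ∘ there ∘ here

  two-other-vertices : ∀ {e} → e ∈ edges G → ∀ a → ∃₂ λ p q → p ∈ₛ e × q ∈ₛ e × p ≢ a × q ≢ a × p ≢ q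
  two-other-vertices e∈ a with other-vertex e∈ a a
  ... | p , p∈ , p≢a , _ with other-vertex e∈ a p
  ...   | q , q∈ , q≢a , q≢p = p , q , p∈ , q∈ , p≢a , q≢a , q≢p ∘ sym

  opaque
    unfolding #⟨_∖_⟩

    deg≡# : ∀ v → deg G v ≡ #⟨ v ∷ [] ∖ [] ⟩
    deg≡# v = cong length (filter-≐ (v ∈?_) (through? (v ∷ []) [])
                ((λ v∈ → v∈ ∷ [] , []) , λ { (v∈ ∷ [] , []) → v∈ }) (edges G))

    #-split : ∀ w {S F} → #⟨ S ∖ F ⟩ ≡ #⟨ w ∷ S ∖ F ⟩ + #⟨ S ∖ w ∷ F ⟩
    #-split w {S} {F} = length-filter-⊎ (through? S F) (through? (w ∷ S) F) (through? S (w ∷ F)) split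
      (λ { (_ ∷ ins , outs) → ins , outs }) (λ { (ins , _ ∷ outs) → ins , outs })
      (λ { (w∈ ∷ _ , _) (_ , w∉ ∷ _) → w∉ w∈ }) (edges G)
      where
      split : ∀ {e} → Through S F e → Through (w ∷ S) F e ⊎ Through S (w ∷ F) e
      split {e} (ins , outs) with w ∈? e
      ... | yes w∈ = inj₁ (w∈ ∷ ins , outs)
      ... | no w∉  = inj₂ (ins , w∉ ∷ outs)

    #-mono : ∀ {S F S′ F′} → (∀ {e} → e ∈ edges G → Through S F e → Through S′ F′ e) → #⟨ S ∖ F ⟩ ≤ #⟨ S′ ∖ F′ ⟩
    #-mono {S} {F} {S′} {F′} = length-filter-mono (through? S F) (through? S′ F′) (edges G)

    Edge⇒0<# : ∀ {S F} → Edge⟨ S ∖ F ⟩ → 0 < #⟨ S ∖ F ⟩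
    Edge⇒0<# {S} {F} (e , e∈ , through) = filter-some (through? S F) (Any.map (λ { refl → through }) e∈)

    0<#⇒Edge : ∀ {S F} → 0 < #⟨ S ∖ F ⟩ → Edge⟨ S ∖ F ⟩
    0<#⇒Edge {S} {F} pos = find (filter-some⁻ (through? S F) (edges G) pos)

    #⟨triple⟩≤1 : ∀ {a b c} → a ≢ b → a ≢ c → b ≢ c → #⟨ a ∷ b ∷ c ∷ [] ∖ [] ⟩ ≤ 1
    #⟨triple⟩≤1 {a} {b} {c} a≢b a≢c b≢c =
      length-≤-of-injection (≡-dec _≟ᵇ_) id (filter⁺ (through? _ []) (unique G)) is-triple (λ _ _ → id)
      where
      is-triple : ∀ {e} → e ∈ filter (through? (a ∷ b ∷ c ∷ []) []) (edges G) → e ∈ triple a b c ∷ []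
      is-triple e∈ with ∈-filter⁻ (through? _ []) {xs = edges G} e∈
      ... | e∈G , (a∈ ∷ b∈ ∷ c∈ ∷ []) , [] = here (edge≡triple e∈G a≢b a≢c b≢c a∈ b∈ c∈)

    codegree+2≤n : ∀ {u v} → u ≢ v → #⟨ u ∷ v ∷ [] ∖ [] ⟩ + 2 ≤ n
    codegree+2≤n {u} {v} u≢v = begin
      #⟨ u ∷ v ∷ [] ∖ [] ⟩ + 2                          ≤⟨ +-monoˡ-≤ 2 (length-≤-of-injection (≡-dec _≟ᵇ_) id edges-unique third (λ _ _ → id)) ⟩
      length (map (triple u v) (allFinExcept uv)) + 2  ≡⟨ cong (_+ 2) (length-map (triple u v) (allFinExcept uv)) ⟩
      length (allFinExcept uv) + 2                     ≡⟨ length-allFinExcept ((u≢v ∷ []) ∷ [] ∷ []) ⟩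
      n                                                ∎
      where
      uv : List (Fin n)
      uv = u ∷ v ∷ []
      edges-unique : Unique (filter (through? uv []) (edges G))
      edges-unique = filter⁺ (through? uv []) (unique G)
      third : ∀ {e} → e ∈ filter (through? uv []) (edges G) → e ∈ map (triple u v) (allFinExcept uv)
      third e∈ with ∈-filter⁻ (through? uv []) {xs = edges G} e∈
      ... | e∈G , (u∈ ∷ v∈ ∷ []) , [] with other-vertex e∈G u v
      ...   | z , z∈ , z≢u , z≢v =
        subst (_∈ _) (sym (edge≡triple e∈G u≢v (z≢u ∘ sym) (z≢v ∘ sym) u∈ v∈ z∈))
              (∈-map⁺ (triple u v) (∈-allFinExcept⁺ λ { (here z≡u) → z≢u z≡u ; (there (here z≡v)) → z≢v z≡v }))

  #-drop-avoided : ∀ {S F} → #⟨ S ∖ F ⟩ ≤ #⟨ S ∖ [] ⟩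
  #-drop-avoided = #-mono λ _ (ins , _) → ins , []

  #-forced : ∀ w {S F} → ¬ Edge⟨ S ∖ w ∷ F ⟩ → #⟨ S ∖ F ⟩ ≤ #⟨ w ∷ S ∖ F ⟩
  #-forced w no-edge = #-mono λ {e} e∈ (ins , outs) →
    decidable-stable (w ∈? e) (λ w∉ → no-edge (e , e∈ , ins , w∉ ∷ outs)) ∷ ins , outs

  #-peel : ∀ w {S F} k {m} → k + m ≤ #⟨ S ∖ F ⟩ → #⟨ w ∷ S ∖ F ⟩ ≤ k → m ≤ #⟨ S ∖ w ∷ F ⟩
  #-peel w k {m} k+m≤# w≤k = ≤-cancel-boundˡ k (subst (k + m ≤_) (#-split w) k+m≤#) w≤k

  #≤length+# : ∀ S F → All (λ w → #⟨ w ∷ S ∖ [] ⟩ ≤ 1) F → #⟨ S ∖ [] ⟩ ≤ length F + #⟨ S ∖ F ⟩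
  #≤length+# S []      []           = ≤-refl
  #≤length+# S (w ∷ F) (w≤1 ∷ w≤1s) = begin
    #⟨ S ∖ [] ⟩                                   ≤⟨ #≤length+# S F w≤1s ⟩
    length F + #⟨ S ∖ F ⟩                          ≡⟨ cong (length F +_) (#-split w) ⟩
    length F + (#⟨ w ∷ S ∖ F ⟩ + #⟨ S ∖ w ∷ F ⟩)  ≤⟨ +-monoʳ-≤ (length F) (+-monoˡ-≤ _ (≤-trans #-drop-avoided w≤1)) ⟩
    length F + suc #⟨ S ∖ w ∷ F ⟩                  ≡⟨ +-suc (length F) _ ⟩
    suc (length F + #⟨ S ∖ w ∷ F ⟩)                ∎

  fresh-third-vertex : ∀ {u v} F → u ≢ v → All (λ w → w ≢ u × w ≢ v) F → length F < #⟨ u ∷ v ∷ [] ∖ [] ⟩ →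
                       ∃ λ a → Edge⟨ u ∷ a ∷ v ∷ [] ∖ [] ⟩ × a ≢ u × a ≢ v × All (a ≢_) F
  fresh-third-vertex {u} {v} F u≢v fresh F<# with 0<#⇒Edge {u ∷ v ∷ []} {F} (m<m+n⇒0<n (length F) F<F+#)
    where
    F<F+# : length F < length F + #⟨ u ∷ v ∷ [] ∖ F ⟩
    F<F+# = <-≤-trans F<# (#≤length+# (u ∷ v ∷ []) F (All.map (λ (w≢u , w≢v) → #⟨triple⟩≤1 w≢u w≢v u≢v) fresh))
  ... | e , e∈ , (u∈ ∷ v∈ ∷ []) , F∉e with other-vertex e∈ u v
  ...   | a , a∈ , a≢u , a≢v =
    a , (e , e∈ , (u∈ ∷ a∈ ∷ v∈ ∷ []) , []) , a≢u , a≢v , All.map (λ w∉e a≡w → w∉e (subst (_∈ₛ e) a≡w a∈)) F∉e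

  Edge-reverse : ∀ {a b c F} → Edge⟨ a ∷ b ∷ c ∷ [] ∖ F ⟩ → Edge⟨ c ∷ b ∷ a ∷ [] ∖ F ⟩
  Edge-reverse (e , e∈ , (a∈ ∷ b∈ ∷ c∈ ∷ []) , outs) = e , e∈ , (c∈ ∷ b∈ ∷ a∈ ∷ []) , outs

  Edge-swap₁₂ : ∀ {a b c F} → Edge⟨ a ∷ b ∷ c ∷ [] ∖ F ⟩ → Edge⟨ b ∷ a ∷ c ∷ [] ∖ F ⟩
  Edge-swap₁₂ (e , e∈ , (a∈ ∷ b∈ ∷ c∈ ∷ []) , outs) = e , e∈ , (b∈ ∷ a∈ ∷ c∈ ∷ []) , outs

  Edge-swap₂₃ : ∀ {a b c F} → Edge⟨ a ∷ b ∷ c ∷ [] ∖ F ⟩ → Edge⟨ a ∷ c ∷ b ∷ [] ∖ F ⟩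
  Edge-swap₂₃ (e , e∈ , (a∈ ∷ b∈ ∷ c∈ ∷ []) , outs) = e , e∈ , (a∈ ∷ c∈ ∷ b∈ ∷ []) , outs

  Edge⇒triple∈ : ∀ {a b c F} → a ≢ b → a ≢ c → b ≢ c → Edge⟨ a ∷ b ∷ c ∷ [] ∖ F ⟩ → triple a b c ∈ edges G
  Edge⇒triple∈ a≢b a≢c b≢c (e , e∈ , (a∈ ∷ b∈ ∷ c∈ ∷ []) , _) = subst (_∈ edges G) (edge≡triple e∈ a≢b a≢c b≢c a∈ b∈ c∈) e∈

  InP₃ : Fin n → Set
  InP₃ x = Σ (Fin 7 → Fin n) λ φ → IsP₃Copy G φ × ∃ λ i → φ i ≡ x

  P₃-path : ∀ {v₀ v₁ v₂ v₃ v₄ v₅ v₆} → Vec.Unique (v₀ ∷ v₁ ∷ v₂ ∷ v₃ ∷ v₄ ∷ v₅ ∷ v₆ ∷ []) →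
            Edge⟨ v₀ ∷ v₁ ∷ v₂ ∷ [] ∖ [] ⟩ → Edge⟨ v₂ ∷ v₃ ∷ v₄ ∷ [] ∖ [] ⟩ → Edge⟨ v₄ ∷ v₅ ∷ v₆ ∷ [] ∖ [] ⟩ →
            ∀ i → InP₃ (lookup (v₀ ∷ v₁ ∷ v₂ ∷ v₃ ∷ v₄ ∷ v₅ ∷ v₆ ∷ []) i)
  P₃-path distinct@((d₀₁ ∷ d₀₂ ∷ _) ∷ (d₁₂ ∷ _) ∷ (d₂₃ ∷ d₂₄ ∷ _) ∷ (d₃₄ ∷ _) ∷ (d₄₅ ∷ d₄₆ ∷ _) ∷ (d₅₆ ∷ _) ∷ _) E₁ E₂ E₃ i =
    lookup (_ ∷ _ ∷ _ ∷ _ ∷ _ ∷ _ ∷ _ ∷ []) ,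
    ((λ {i} {j} → lookup-injective distinct i j) ,
     Edge⇒triple∈ d₀₁ d₀₂ d₁₂ E₁ , Edge⇒triple∈ d₂₃ d₂₄ d₃₄ E₂ , Edge⇒triple∈ d₄₅ d₄₆ d₅₆ E₃) ,
    i , refl

-- The star

allSubsets : ∀ n → List (Subset n)
allSubsets zero    = [] ∷ []
allSubsets (suc n) = map (inside ∷_) (allSubsets n) ++ map (outside ∷_) (allSubsets n)

∈-allSubsets : ∀ {n} (p : Subset n) → p ∈ allSubsets n
∈-allSubsets []            = here refl
∈-allSubsets (inside ∷ p)  = ∈-++⁺ˡ (∈-map⁺ (inside ∷_) (∈-allSubsets p))
∈-allSubsets (outside ∷ p) = ∈-++⁺ʳ (map (inside ∷_) (allSubsets _)) (∈-map⁺ (outside ∷_) (∈-allSubsets p))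

allSubsets-unique : ∀ n → Unique (allSubsets n)
allSubsets-unique zero    = [] ∷ []
allSubsets-unique (suc n) =
  ++⁺ (map⁺ ∷-injectiveʳ (allSubsets-unique n)) (map⁺ ∷-injectiveʳ (allSubsets-unique n)) disjoint
  where
  ∷-injectiveʳ : ∀ {s} {p q : Subset n} → _≡_ {A = Subset (suc n)} (s ∷ p) (s ∷ q) → p ≡ q
  ∷-injectiveʳ refl = refl
  disjoint : ∀ {p} → ¬ (p ∈ map (inside ∷_) (allSubsets n) × p ∈ map (outside ∷_) (allSubsets n))
  disjoint (p∈ᵢ , p∈ₒ) with ∈-map⁻ (inside ∷_) p∈ᵢ | ∈-map⁻ (outside ∷_) p∈ₒ
  ... | _ , _ , refl | _ , _ , ()

P₃-ends-disjoint : ∀ {n} {φ : Fin 7 → Fin n} {w} → Injective _≡_ _≡_ φ →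
                   w ∈ₛ triple (φ (# 0)) (φ (# 1)) (φ (# 2)) → w ∈ₛ triple (φ (# 4)) (φ (# 5)) (φ (# 6)) → ⊥
P₃-ends-disjoint {φ = φ} φ-inj w∈₁ w∈₃ with ∈-map⁻ φ (∈-triple⁻ w∈₁) | ∈-map⁻ φ (∈-triple⁻ w∈₃)
... | i , i∈ , refl | j , j∈ , φi≡φj with φ-inj φi≡φj
...   | refl = apart i∈ j∈
  where
  apart : ∀ {i} → i ∈ # 0 ∷ # 1 ∷ # 2 ∷ [] → i ∉ # 4 ∷ # 5 ∷ # 6 ∷ []
  apart (here refl)                 = λ { (here ()) ; (there (here ())) ; (there (there (here ()))) }
  apart (there (here refl))         = λ { (here ()) ; (there (here ())) ; (there (there (here ()))) }
  apart (there (there (here refl))) = λ { (here ()) ; (there (here ())) ; (there (there (here ()))) }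

star-edge? : ∀ {n} (e : Subset (suc n)) → Dec (zero ∈ₛ e × ∣ e ∣ ≡ 3)
star-edge? e = zero ∈? e ×-dec ∣ e ∣ ℕ.≟ 3

star : ∀ n → 3-Graph (suc n)
star n = record
  { edges  = filter star-edge? (allSubsets (suc n))
  ; unique = filter⁺ star-edge? (allSubsets-unique (suc n))
  ; size3  = All.tabulate (proj₂ ∘ proj₂ ∘ ∈-filter⁻ star-edge? {xs = allSubsets (suc n)})
  }

star-has-no-P₃ : ∀ {n} {φ : Fin 7 → Fin (suc n)} → ¬ IsP₃Copy (star n) φ
star-has-no-P₃ {n} (φ-inj , e₁∈ , _ , e₃∈) = P₃-ends-disjoint φ-inj (centre∈ e₁∈) (centre∈ e₃∈)
  where
  centre∈ : ∀ {e} → e ∈ edges (star n) → zero ∈ₛ e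
  centre∈ = proj₁ ∘ proj₂ ∘ ∈-filter⁻ star-edge? {xs = allSubsets (suc n)}

star-not-covered : ∀ {n} → ¬ HasP₃Covering (star n)
star-not-covered covering = star-has-no-P₃ (proj₁ (proj₂ (covering zero)))

leaf : ∀ {m} → Fin (suc (suc m)) → Fin (suc (suc m))
leaf zero    = suc zero
leaf (suc k) = suc k

zero≢leaf : ∀ {m} (v : Fin (suc (suc m))) → zero ≢ leaf v
zero≢leaf zero    ()
zero≢leaf (suc k) ()

∈-triple-zero-leaf : ∀ {m} (v z : Fin (suc (suc m))) → v ∈ₛ triple zero (leaf v) z
∈-triple-zero-leaf zero    z = ∈-triple⁺ {a = zero} {b = suc zero} {c = z} (here refl)
∈-triple-zero-leaf (suc k) z = ∈-triple⁺ {a = zero} {b = suc k} {c = z} (there (here refl))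

star-min-degree : ∀ m → MinDeg≥ (star (suc m)) m
star-min-degree m v = begin
  m                                  ≡⟨ +-cancelʳ-≡ 2 m _ (trans (+-comm m 2) (sym (length-allFinExcept {xs = spoke} spoke!))) ⟩
  length (allFinExcept spoke)        ≤⟨ length-≤-of-injection (≡-dec _≟ᵇ_) (triple zero (leaf v)) (allFinExcept-unique _) into inj ⟩
  deg (star (suc m)) v               ∎
  where
  spoke : List (Fin (suc (suc m)))
  spoke = zero ∷ leaf v ∷ []
  spoke! : Unique spoke
  spoke! = (zero≢leaf v ∷ []) ∷ [] ∷ []
  into : ∀ {z} → z ∈ allFinExcept spoke → triple zero (leaf v) z ∈ filter (v ∈?_) (edges (star (suc m)))
  into {z} z∈ = ∈-filter⁺ (v ∈?_) (∈-filter⁺ star-edge? (∈-allSubsets _)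
                  (∈-triple⁺ (here refl) , ∣triple∣≡3 (zero≢leaf v) (z∉ ∘ here ∘ sym) (z∉ ∘ there ∘ here ∘ sym)))
                  (∈-triple-zero-leaf v z)
    where
    z∉ : z ∉ spoke
    z∉ = ∈-allFinExcept⁻ z∈
  inj : ∀ {a b} → a ∈ allFinExcept spoke → b ∈ allFinExcept spoke → triple zero (leaf v) a ≡ triple zero (leaf v) b → a ≡ b
  inj {a} a∈ _ eq with ∈-triple⁻ (subst (a ∈ₛ_) eq (∈-triple⁺ {a = zero} {b = leaf v} {c = a} (there (there (here refl)))))
  ... | here a≡zero              = contradiction (here a≡zero) (∈-allFinExcept⁻ a∈)
  ... | there (here a≡leaf)      = contradiction (there (here a≡leaf)) (∈-allFinExcept⁻ a∈)
  ... | there (there (here a≡b)) = a≡b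

-- A vertex in no copy of P₃

module MissedVertex {n : ℕ} (G : 3-Graph n) (δ : ∀ v → n + 5 ≤ deg G v)
                    (x : Fin n) (x∉P₃ : ¬ EdgeCounting.InP₃ G x) where

  open EdgeCounting G

  7≤#avoiding : ∀ {u v} → u ≢ v → 7 ≤ #⟨ v ∷ [] ∖ u ∷ [] ⟩
  7≤#avoiding {u} {v} u≢v = +-cancelˡ-≤ #⟨ u ∷ v ∷ [] ∖ [] ⟩ 7 _ (begin
    #⟨ u ∷ v ∷ [] ∖ [] ⟩ + 7                      ≡⟨ sym (+-assoc _ 2 5) ⟩
    #⟨ u ∷ v ∷ [] ∖ [] ⟩ + 2 + 5                  ≤⟨ +-monoˡ-≤ 5 (codegree+2≤n u≢v) ⟩
    n + 5                                         ≤⟨ δ v ⟩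
    deg G v                                       ≡⟨ deg≡# v ⟩
    #⟨ v ∷ [] ∖ [] ⟩                              ≡⟨ #-split u ⟩
    #⟨ u ∷ v ∷ [] ∖ [] ⟩ + #⟨ v ∷ [] ∖ u ∷ [] ⟩  ∎)

  Heavy : Fin n → Set
  Heavy b = 5 ≤ #⟨ x ∷ b ∷ [] ∖ [] ⟩

  record Partner (b d c : Fin n) : Set where
    constructor mkPartner
    field
      c≢x  : c ≢ x
      c≢b  : c ≢ b
      c≢d  : c ≢ d
      edge : Edge⟨ b ∷ c ∷ d ∷ [] ∖ [] ⟩

  open Partner

  Partner-swap : ∀ {b d c} → Partner b d c → Partner d b c
  Partner-swap P = mkPartner (c≢x P) (c≢d P) (c≢b P) (Edge-reverse (edge P))

  module _ {b d : Fin n} (heavy-b : Heavy b) (x≢b : x ≢ b) (x≢d : x ≢ d) (b≢d : b ≢ d) where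

    -- The copy is (x a b)(b c d)(d p q).
    no-pendant : ∀ {c} → Partner b d c → ¬ Edge⟨ d ∷ [] ∖ x ∷ b ∷ c ∷ [] ⟩
    no-pendant {c} P (e , e∈ , d∈ ∷ [] , x∉ ∷ b∉ ∷ c∉ ∷ []) with two-other-vertices e∈ d
    ... | p , q , p∈ , q∈ , p≢d , q≢d , p≢q
      with fresh-third-vertex (c ∷ d ∷ p ∷ q ∷ []) x≢b
             ((c≢x P , c≢b P) ∷ (≢-sym x≢d , ≢-sym b≢d) ∷ (∈∧∉⇒≢ p∈ x∉ , ∈∧∉⇒≢ p∈ b∉) ∷ (∈∧∉⇒≢ q∈ x∉ , ∈∧∉⇒≢ q∈ b∉) ∷ [])
             heavy-b
    ...   | a , E₁ , a≢x , a≢b , a≢c ∷ a≢d ∷ a≢p ∷ a≢q ∷ [] =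
      x∉P₃ (P₃-path
        ( (≢-sym a≢x ∷ x≢b ∷ ≢-sym (c≢x P) ∷ x≢d ∷ ∉∧∈⇒≢ x∉ p∈ ∷ ∉∧∈⇒≢ x∉ q∈ ∷ [])
        ∷ (a≢b ∷ a≢c ∷ a≢d ∷ a≢p ∷ a≢q ∷ [])
        ∷ (≢-sym (c≢b P) ∷ b≢d ∷ ∉∧∈⇒≢ b∉ p∈ ∷ ∉∧∈⇒≢ b∉ q∈ ∷ [])
        ∷ (c≢d P ∷ ∉∧∈⇒≢ c∉ p∈ ∷ ∉∧∈⇒≢ c∉ q∈ ∷ [])
        ∷ (≢-sym p≢d ∷ ≢-sym q≢d ∷ [])
        ∷ (p≢q ∷ []) ∷ [] ∷ [])
        E₁ (edge P) (e , e∈ , d∈ ∷ p∈ ∷ q∈ ∷ [] , []) zero)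

    partner-in-pendant-edges : ∀ {c e} → Partner b d c → e ∈ edges G → d ∈ₛ e → x ∉ₛ e → b ∉ₛ e → c ∈ₛ e
    partner-in-pendant-edges {c} {e} P e∈ d∈ x∉ b∉ =
      decidable-stable (c ∈? e) (λ c∉ → no-pendant P (e , e∈ , d∈ ∷ [] , x∉ ∷ b∉ ∷ c∉ ∷ []))

    three-partners : ∀ {c₁ c₂ c₃ e} → Partner b d c₁ → Partner b d c₂ → Partner b d c₃ →
                     c₁ ≢ c₂ → c₁ ≢ c₃ → c₂ ≢ c₃ → e ∈ edges G → d ∈ₛ e → x ∉ₛ e → b ∉ₛ e → ⊥
    three-partners P₁ P₂ P₃ c₁≢c₂ c₁≢c₃ c₂≢c₃ e∈ d∈ x∉ b∉ =
      ¬four-in-edge e∈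
        ((≢-sym (c≢d P₁) ∷ ≢-sym (c≢d P₂) ∷ ≢-sym (c≢d P₃) ∷ []) ∷ (c₁≢c₂ ∷ c₁≢c₃ ∷ []) ∷ (c₂≢c₃ ∷ []) ∷ [] ∷ [])
        (d∈ ∷ in-e P₁ ∷ in-e P₂ ∷ in-e P₃ ∷ [])
      where
      in-e : ∀ {c} → Partner b d c → c ∈ₛ _
      in-e P = partner-in-pendant-edges P e∈ d∈ x∉ b∉

    third-partner : ∀ {c₁ c₂} → Partner b d c₁ → Partner b d c₂ → c₁ ≢ c₂ →
                    ∃ λ c₃ → Partner b d c₃ × c₁ ≢ c₃ × c₂ ≢ c₃
    third-partner {c₁} {c₂} P₁ P₂ c₁≢c₂
      with fresh-third-vertex (x ∷ c₁ ∷ c₂ ∷ []) b≢d ((x≢b , x≢d) ∷ (c≢b P₁ , c≢d P₁) ∷ (c≢b P₂ , c≢d P₂) ∷ []) 3<#bd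
      where
      d-edges≤1 : #⟨ d ∷ [] ∖ b ∷ x ∷ [] ⟩ ≤ 1
      d-edges≤1 = ≤-trans
        (#-mono λ e∈ → λ { (d∈ ∷ [] , b∉ ∷ x∉ ∷ []) →
          (d∈ ∷ partner-in-pendant-edges P₁ e∈ d∈ x∉ b∉ ∷ partner-in-pendant-edges P₂ e∈ d∈ x∉ b∉ ∷ []) , [] })
        (#⟨triple⟩≤1 (≢-sym (c≢d P₁)) (≢-sym (c≢d P₂)) c₁≢c₂)
      3<#bd : 3 < #⟨ b ∷ d ∷ [] ∖ [] ⟩
      3<#bd = ≤-trans (≤-cancel-boundʳ 3 (subst (7 ≤_) (#-split b) (7≤#avoiding x≢d)) (≤-trans d-edges≤1 (s≤s z≤n)))
                      #-drop-avoided
    ... | c₃ , E , c₃≢b , c₃≢d , c₃≢x ∷ c₃≢c₁ ∷ c₃≢c₂ ∷ [] =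
      c₃ , mkPartner c₃≢x c₃≢b c₃≢d E , ≢-sym c₃≢c₁ , ≢-sym c₃≢c₂

  no-three-partners : ∀ {b d c₁ c₂ c₃} → Heavy b → x ≢ b → x ≢ d → b ≢ d →
                      Partner b d c₁ → Partner b d c₂ → Partner b d c₃ → c₁ ≢ c₂ → c₁ ≢ c₃ → c₂ ≢ c₃ → ⊥
  no-three-partners {b} {d} {c₁} heavy-b x≢b x≢d b≢d P₁ P₂ P₃ c₁≢c₂ c₁≢c₃ c₂≢c₃ =
    contradiction (≤-trans (7≤#avoiding (≢-sym (c≢x P₁))) c₁-edges≤1) λ { (s≤s ()) }
    where
    no-d-edge : ∀ {e} → e ∈ edges G → d ∈ₛ e → x ∉ₛ e → b ∉ₛ e → ⊥
    no-d-edge = three-partners heavy-b x≢b x≢d b≢d P₁ P₂ P₃ c₁≢c₂ c₁≢c₃ c₂≢c₃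
    heavy-d : Heavy d
    heavy-d = ≤-trans (m≤n+m 5 2) (≤-trans (7≤#avoiding b≢d)
                (≤-trans (#-forced x λ { (e , e∈ , d∈ ∷ [] , x∉ ∷ b∉ ∷ []) → no-d-edge e∈ d∈ x∉ b∉ }) #-drop-avoided))
    no-b-edge : ∀ {e} → e ∈ edges G → b ∈ₛ e → x ∉ₛ e → d ∉ₛ e → ⊥
    no-b-edge = three-partners heavy-d x≢d x≢b (≢-sym b≢d)
                  (Partner-swap P₁) (Partner-swap P₂) (Partner-swap P₃) c₁≢c₂ c₁≢c₃ c₂≢c₃
    d-partner : Partner b c₁ d
    d-partner = mkPartner (≢-sym x≢d) (≢-sym b≢d) (≢-sym (c≢d P₁)) (Edge-swap₂₃ (edge P₁))
    c₁-edges≤1 : #⟨ c₁ ∷ [] ∖ x ∷ [] ⟩ ≤ 1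
    c₁-edges≤1 = ≤-trans (#-mono through-bd) (#⟨triple⟩≤1 b≢d (≢-sym (c≢b P₁)) (≢-sym (c≢d P₁)))
      where
      through-bd : ∀ {e} → e ∈ edges G → Through (c₁ ∷ []) (x ∷ []) e → Through (b ∷ d ∷ c₁ ∷ []) [] e
      through-bd {e} e∈ (c₁∈ ∷ [] , x∉ ∷ []) with b ∈? e | d ∈? e
      ... | yes b∈ | yes d∈ = (b∈ ∷ d∈ ∷ c₁∈ ∷ []) , []
      ... | yes b∈ | no d∉  = ⊥-elim (no-b-edge e∈ b∈ x∉ d∉)
      ... | no b∉  | yes d∈ = ⊥-elim (no-d-edge e∈ d∈ x∉ b∉)
      ... | no b∉  | no d∉  = ⊥-elim (no-pendant heavy-b x≢b (≢-sym (c≢x P₁)) (≢-sym (c≢b P₁)) d-partner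
                                       (e , e∈ , c₁∈ ∷ [] , x∉ ∷ b∉ ∷ d∉ ∷ []))

  no-two-partners : ∀ {b d c₁ c₂} → Heavy b → x ≢ b → x ≢ d → b ≢ d →
                    Partner b d c₁ → Partner b d c₂ → c₁ ≢ c₂ → ⊥
  no-two-partners heavy-b x≢b x≢d b≢d P₁ P₂ c₁≢c₂ with third-partner heavy-b x≢b x≢d b≢d P₁ P₂ c₁≢c₂
  ... | _ , P₃ , c₁≢c₃ , c₂≢c₃ = no-three-partners heavy-b x≢b x≢d b≢d P₁ P₂ P₃ c₁≢c₂ c₁≢c₃ c₂≢c₃

  codegree-off-x≤1 : ∀ {b w} → Heavy b → x ≢ b → x ≢ w → b ≢ w → #⟨ b ∷ w ∷ [] ∖ x ∷ [] ⟩ ≤ 1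
  codegree-off-x≤1 {b} {w} heavy-b x≢b x≢w b≢w with 0 <? #⟨ b ∷ w ∷ [] ∖ x ∷ [] ⟩
  ... | no ¬pos = ≤-trans (≮⇒≥ ¬pos) z≤n
  ... | yes pos with 0<#⇒Edge pos
  ...   | e₀ , e₀∈ , b∈₀ ∷ w∈₀ ∷ [] , x∉₀ ∷ [] with other-vertex e₀∈ b w
  ...     | z , z∈₀ , z≢b , z≢w = ≤-trans (#-mono through-z) (#⟨triple⟩≤1 z≢b z≢w b≢w)
    where
    partner : ∀ {e z} → e ∈ edges G → b ∈ₛ e → w ∈ₛ e → z ∈ₛ e → x ∉ₛ e → z ≢ b → z ≢ w → Partner b w z
    partner e∈ b∈ w∈ z∈ x∉ z≢b z≢w =
      mkPartner (∈∧∉⇒≢ z∈ x∉) z≢b z≢w (_ , e∈ , (b∈ ∷ z∈ ∷ w∈ ∷ []) , [])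
    through-z : ∀ {e} → e ∈ edges G → Through (b ∷ w ∷ []) (x ∷ []) e → Through (z ∷ b ∷ w ∷ []) [] e
    through-z {e} e∈ (b∈ ∷ w∈ ∷ [] , x∉ ∷ []) = z∈ ∷ b∈ ∷ w∈ ∷ [] , []
      where
      z∈ : z ∈ₛ e
      z∈ = decidable-stable (z ∈? e) λ z∉ →
        let (z′ , z′∈ , z′≢b , z′≢w) = other-vertex e∈ b w in
        no-two-partners heavy-b x≢b x≢w b≢w (partner e₀∈ b∈₀ w∈₀ z∈₀ x∉₀ z≢b z≢w)
                                          (partner e∈ b∈ w∈ z′∈ x∉ z′≢b z′≢w) (∉∧∈⇒≢ z∉ z′∈)

  partner-end-heavy : ∀ {b d c} → Heavy b → x ≢ b → x ≢ d → b ≢ d → Partner b d c → Heavy d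
  partner-end-heavy {b} {d} {c} heavy-b x≢b x≢d b≢d P = +-cancelˡ-≤ 2 5 _ (≤-trans
    (subst (7 ≤_) (#-split b) (7≤#avoiding (c≢d P)))
    (+-mono-≤ bd≤2 (≤-trans (#-forced x (no-pendant heavy-b x≢b x≢d b≢d P)) #-drop-avoided)))
    where
    bd≤2 : #⟨ b ∷ d ∷ [] ∖ c ∷ [] ⟩ ≤ 2
    bd≤2 = begin
      #⟨ b ∷ d ∷ [] ∖ c ∷ [] ⟩                             ≤⟨ #-drop-avoided ⟩
      #⟨ b ∷ d ∷ [] ∖ [] ⟩                                  ≡⟨ #-split x ⟩
      #⟨ x ∷ b ∷ d ∷ [] ∖ [] ⟩ + #⟨ b ∷ d ∷ [] ∖ x ∷ [] ⟩  ≤⟨ +-mono-≤ (#⟨triple⟩≤1 x≢b x≢d b≢d) (codegree-off-x≤1 heavy-b x≢b x≢d b≢d) ⟩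
      2                                                     ∎

  -- The copy is (x a d)(d c b)(b p q).
  no-return : ∀ {b d c} → Heavy b → x ≢ b → x ≢ d → b ≢ d → Partner b d c → Heavy d → ⊥
  no-return {b} {d} {c} heavy-b x≢b x≢d b≢d P heavy-d
    with fresh-third-vertex (b ∷ c ∷ []) x≢d ((≢-sym x≢b , b≢d) ∷ (c≢x P , c≢d P) ∷ []) (≤-trans (s≤s (s≤s (s≤s z≤n))) heavy-d)
  ... | a , E₁ , a≢x , a≢d , a≢b ∷ a≢c ∷ [] with 0<#⇒Edge (≤-trans (s≤s z≤n) 4≤#rest)
    where
    b-edges≤1 : ∀ {w F} → x ∈ F → x ≢ w → b ≢ w → #⟨ w ∷ b ∷ [] ∖ F ⟩ ≤ 1
    b-edges≤1 x∈F x≢w b≢w = ≤-trans (#-mono λ _ → λ { (w∈ ∷ b∈ ∷ [] , outs) → (b∈ ∷ w∈ ∷ []) , All.lookup outs x∈F ∷ [] })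
                                    (codegree-off-x≤1 heavy-b x≢b x≢w b≢w)
    4≤#rest : 4 ≤ #⟨ b ∷ [] ∖ d ∷ c ∷ a ∷ x ∷ [] ⟩
    4≤#rest = #-peel d 1 (#-peel c 1 (#-peel a 1 (7≤#avoiding x≢b)
                                                (b-edges≤1 (here refl) (≢-sym a≢x) (≢-sym a≢b)))
                                     (b-edges≤1 (there (here refl)) (≢-sym (c≢x P)) (≢-sym (c≢b P))))
                         (b-edges≤1 (there (there (here refl))) x≢d b≢d)
  ...   | e₃ , e₃∈ , b∈ ∷ [] , d∉ ∷ c∉ ∷ a∉ ∷ x∉ ∷ [] with two-other-vertices e₃∈ b
  ...     | p , q , p∈ , q∈ , p≢b , q≢b , p≢q =
    x∉P₃ (P₃-path
      ( (≢-sym a≢x ∷ x≢d ∷ ≢-sym (c≢x P) ∷ x≢b ∷ ∉∧∈⇒≢ x∉ p∈ ∷ ∉∧∈⇒≢ x∉ q∈ ∷ [])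
      ∷ (a≢d ∷ a≢c ∷ a≢b ∷ ∉∧∈⇒≢ a∉ p∈ ∷ ∉∧∈⇒≢ a∉ q∈ ∷ [])
      ∷ (≢-sym (c≢d P) ∷ ≢-sym b≢d ∷ ∉∧∈⇒≢ d∉ p∈ ∷ ∉∧∈⇒≢ d∉ q∈ ∷ [])
      ∷ (c≢b P ∷ ∉∧∈⇒≢ c∉ p∈ ∷ ∉∧∈⇒≢ c∉ q∈ ∷ [])
      ∷ (≢-sym p≢b ∷ ≢-sym q≢b ∷ [])
      ∷ (p≢q ∷ []) ∷ [] ∷ [])
      E₁ (Edge-reverse (edge P)) (e₃ , e₃∈ , b∈ ∷ p∈ ∷ q∈ ∷ [] , []) zero)

  heavy-partner-impossible : ∀ {b} → x ≢ b → Heavy b → ⊥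
  heavy-partner-impossible {b} x≢b heavy-b with 0<#⇒Edge (≤-trans (s≤s z≤n) (7≤#avoiding x≢b))
  ... | e₀ , e₀∈ , b∈ ∷ [] , x∉ ∷ [] with two-other-vertices e₀∈ b
  ...   | c , d , c∈ , d∈ , c≢b , d≢b , c≢d =
    no-return heavy-b x≢b x≢d (≢-sym d≢b) P (partner-end-heavy heavy-b x≢b x≢d (≢-sym d≢b) P)
    where
    x≢d : x ≢ d
    x≢d = ∉∧∈⇒≢ x∉ d∈
    P : Partner b d c
    P = mkPartner (∈∧∉⇒≢ c∈ x∉) c≢b c≢d (e₀ , e₀∈ , (b∈ ∷ c∈ ∷ d∈ ∷ []) , [])

  module _ (n≥8 : 8 ≤ n) (light : ∀ {w} → x ≢ w → #⟨ x ∷ w ∷ [] ∖ [] ⟩ ≤ 4) {c d : Fin n}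
           (x≢c : x ≢ c) (x≢d : x ≢ d) (c≢d : c ≢ d) (E₀ : Edge⟨ x ∷ c ∷ d ∷ [] ∖ [] ⟩) where

    record DEdge (u v : Fin n) : Set where
      constructor dEdge
      field
        {r} : Subset n
        r∈  : r ∈ edges G
        d∈  : d ∈ₛ r
        u∈  : u ∈ₛ r
        v∈  : v ∈ₛ r
        x∉  : x ∉ₛ r
        c∉  : c ∉ₛ r
        u≢d : u ≢ d
        v≢d : v ≢ d
        u≢v : u ≢ v

    open DEdge

    u≢x : ∀ {u v} → DEdge u v → u ≢ x
    u≢x D = ∈∧∉⇒≢ (u∈ D) (x∉ D)

    v≢x : ∀ {u v} → DEdge u v → v ≢ x
    v≢x D = ∈∧∉⇒≢ (v∈ D) (x∉ D)

    -- Otherwise the edge m through x and the edge through d are disjoint, and (a a′ x)(x c d)(d p q)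
    -- is a copy of P₃.
    x-edge-meets-DEdge : ∀ {m u v} → DEdge u v → m ∈ edges G → x ∈ₛ m → c ∉ₛ m → d ∉ₛ m → u ∉ₛ m → v ∈ₛ m
    x-edge-meets-DEdge {m} {u} {v} D m∈ x∈m c∉m d∉m u∉m with v ∈? m
    ... | yes v∈m = v∈m
    ... | no v∉m  with two-other-vertices m∈ x | two-other-vertices (r∈ D) d
    ...   | a , a′ , a∈ , a′∈ , a≢x , a′≢x , a≢a′ | p , q , p∈ , q∈ , p≢d , q≢d , p≢q =
      ⊥-elim (x∉P₃ (P₃-path
        ( (a≢a′ ∷ a≢x ∷ ∈∧∉⇒≢ a∈ c∉m ∷ ∈∧∉⇒≢ a∈ d∉m ∷ ∉∧∈⇒≢ (off-D a∈) p∈ ∷ ∉∧∈⇒≢ (off-D a∈) q∈ ∷ [])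
        ∷ (a′≢x ∷ ∈∧∉⇒≢ a′∈ c∉m ∷ ∈∧∉⇒≢ a′∈ d∉m ∷ ∉∧∈⇒≢ (off-D a′∈) p∈ ∷ ∉∧∈⇒≢ (off-D a′∈) q∈ ∷ [])
        ∷ (x≢c ∷ x≢d ∷ ∉∧∈⇒≢ (x∉ D) p∈ ∷ ∉∧∈⇒≢ (x∉ D) q∈ ∷ [])
        ∷ (c≢d ∷ ∉∧∈⇒≢ (c∉ D) p∈ ∷ ∉∧∈⇒≢ (c∉ D) q∈ ∷ [])
        ∷ (≢-sym p≢d ∷ ≢-sym q≢d ∷ [])
        ∷ (p≢q ∷ []) ∷ [] ∷ [])
        (m , m∈ , a∈ ∷ a′∈ ∷ x∈m ∷ [] , []) E₀ (_ , r∈ D , d∈ D ∷ p∈ ∷ q∈ ∷ [] , []) (suc (suc zero))))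
      where
      off-D : ∀ {w} → w ∈ₛ m → w ∉ₛ r D
      off-D {w} w∈m w∈r with ∈-triple⁻ (subst (w ∈ₛ_) (edge≡triple (r∈ D) (≢-sym (u≢d D)) (≢-sym (v≢d D)) (u≢v D) (d∈ D) (u∈ D) (v∈ D)) w∈r)
      ... | here refl                 = d∉m w∈m
      ... | there (here refl)         = u∉m w∈m
      ... | there (there (here refl)) = v∉m w∈m

    3≤#d-edges : 3 ≤ #⟨ d ∷ [] ∖ x ∷ c ∷ [] ⟩
    3≤#d-edges = #-peel x 4 (7≤#avoiding c≢d) (≤-trans #-drop-avoided (light x≢d))

    6≤#x-edges : 6 ≤ #⟨ x ∷ [] ∖ d ∷ c ∷ [] ⟩
    6≤#x-edges = #-peel d 3 (#-peel c 4 13≤deg cx≤4) dx≤3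
      where
      13≤deg : 13 ≤ #⟨ x ∷ [] ∖ [] ⟩
      13≤deg = ≤-trans (+-monoˡ-≤ 5 n≥8) (≤-trans (δ x) (≤-reflexive (deg≡# x)))
      cx≤4 : #⟨ c ∷ x ∷ [] ∖ [] ⟩ ≤ 4
      cx≤4 = ≤-trans (#-mono λ _ → λ { (c∈ ∷ x∈ ∷ [] , []) → x∈ ∷ c∈ ∷ [] , [] }) (light x≢c)
      xd≤3 : #⟨ x ∷ d ∷ [] ∖ c ∷ [] ⟩ ≤ 3
      xd≤3 = s≤s⁻¹ (≤-trans (+-monoˡ-≤ _ (Edge⇒0<# (Edge-swap₁₂ E₀))) (≤-trans (≤-reflexive (sym (#-split c))) (light x≢d)))
      dx≤3 : #⟨ d ∷ x ∷ [] ∖ c ∷ [] ⟩ ≤ 3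
      dx≤3 = ≤-trans (#-mono λ _ → λ { (d∈ ∷ x∈ ∷ [] , outs) → x∈ ∷ d∈ ∷ [] , outs }) xd≤3

    no-DEdges-sharing-a-vertex : ∀ {s t t′} → DEdge s t → DEdge s t′ → t ≢ t′ → ⊥
    no-DEdges-sharing-a-vertex {s} {t} {t′} D₁ D₂ t≢t′ =
      contradiction (≤-trans (#-peel s 4 6≤#x-edges (≤-trans sx≤xs (light (≢-sym (u≢x D₁))))) via-t) λ { (s≤s ()) }
      where
      sx≤xs : #⟨ s ∷ x ∷ [] ∖ d ∷ c ∷ [] ⟩ ≤ #⟨ x ∷ s ∷ [] ∖ [] ⟩
      sx≤xs = #-mono λ _ → λ { (s∈ ∷ x∈ ∷ [] , _) → x∈ ∷ s∈ ∷ [] , [] }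
      via-t : #⟨ x ∷ [] ∖ s ∷ d ∷ c ∷ [] ⟩ ≤ 1
      via-t = ≤-trans
        (#-mono λ m∈ → λ { (x∈ ∷ [] , s∉ ∷ d∉ ∷ c∉ ∷ []) →
          x-edge-meets-DEdge D₁ m∈ x∈ c∉ d∉ s∉ ∷ x-edge-meets-DEdge D₂ m∈ x∈ c∉ d∉ s∉ ∷ x∈ ∷ [] , [] })
        (#⟨triple⟩≤1 t≢t′ (v≢x D₁) (v≢x D₂))

    no-disjoint-DEdges : ∀ {p q p′ q′} (D₁ : DEdge p q) (D₂ : DEdge p′ q′) → p ∉ₛ r D₂ → q ∉ₛ r D₂ → ⊥
    no-disjoint-DEdges {p} {q} {p′} {q′} D₁ D₂ p∉r₂ q∉r₂ =
      contradiction (≤-trans (#-peel p′ 1 (#-peel p 2 6≤#x-edges p-edges≤2) p′-edges≤1) rest≤1) λ { (s≤s ()) }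
      where
      p-edges≤2 : #⟨ p ∷ x ∷ [] ∖ d ∷ c ∷ [] ⟩ ≤ 2
      p-edges≤2 = begin
        #⟨ p ∷ x ∷ [] ∖ d ∷ c ∷ [] ⟩                                          ≡⟨ #-split p′ ⟩
        #⟨ p′ ∷ p ∷ x ∷ [] ∖ d ∷ c ∷ [] ⟩ + #⟨ p ∷ x ∷ [] ∖ p′ ∷ d ∷ c ∷ [] ⟩
          ≤⟨ +-mono-≤ (≤-trans #-drop-avoided (#⟨triple⟩≤1 (∈∧∉⇒≢ (u∈ D₂) p∉r₂) (u≢x D₂) (u≢x D₁)))
                      (≤-trans (#-mono via-q′) (#⟨triple⟩≤1 (∈∧∉⇒≢ (v∈ D₂) p∉r₂) (v≢x D₂) (u≢x D₁))) ⟩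
        2                                                                      ∎
        where
        via-q′ : ∀ {m} → m ∈ edges G → Through (p ∷ x ∷ []) (p′ ∷ d ∷ c ∷ []) m → Through (q′ ∷ p ∷ x ∷ []) [] m
        via-q′ m∈ (p∈ ∷ x∈ ∷ [] , p′∉ ∷ d∉ ∷ c∉ ∷ []) = x-edge-meets-DEdge D₂ m∈ x∈ c∉ d∉ p′∉ ∷ p∈ ∷ x∈ ∷ [] , []
      p′-edges≤1 : #⟨ p′ ∷ x ∷ [] ∖ p ∷ d ∷ c ∷ [] ⟩ ≤ 1
      p′-edges≤1 = ≤-trans
        (#-mono λ m∈ → λ { (p′∈ ∷ x∈ ∷ [] , p∉ ∷ d∉ ∷ c∉ ∷ []) → p′∈ ∷ x-edge-meets-DEdge D₁ m∈ x∈ c∉ d∉ p∉ ∷ x∈ ∷ [] , [] })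
        (#⟨triple⟩≤1 (∈∧∉⇒≢ (u∈ D₂) q∉r₂) (u≢x D₂) (v≢x D₁))
      rest≤1 : #⟨ x ∷ [] ∖ p′ ∷ p ∷ d ∷ c ∷ [] ⟩ ≤ 1
      rest≤1 = ≤-trans
        (#-mono λ m∈ → λ { (x∈ ∷ [] , p′∉ ∷ p∉ ∷ d∉ ∷ c∉ ∷ []) →
          x-edge-meets-DEdge D₁ m∈ x∈ c∉ d∉ p∉ ∷ x-edge-meets-DEdge D₂ m∈ x∈ c∉ d∉ p′∉ ∷ x∈ ∷ [] , [] })
        (#⟨triple⟩≤1 (∉∧∈⇒≢ q∉r₂ (v∈ D₂)) (v≢x D₁) (v≢x D₂))

    DEdges-impossible : ⊥
    DEdges-impossible with 0<#⇒Edge (≤-trans (s≤s z≤n) 3≤#d-edges)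
    ... | r₁ , r₁∈ , d∈₁ ∷ [] , x∉₁ ∷ c∉₁ ∷ [] with two-other-vertices r₁∈ d
    ...   | p , q , p∈₁ , q∈₁ , p≢d , q≢d , p≢q with 0 <? #⟨ p ∷ d ∷ [] ∖ q ∷ x ∷ c ∷ [] ⟩
    ...     | yes pos with 0<#⇒Edge pos
    ...       | r₂ , r₂∈ , p∈₂ ∷ d∈₂ ∷ [] , q∉₂ ∷ x∉₂ ∷ c∉₂ ∷ [] with other-vertex r₂∈ d p
    ...         | t , t∈₂ , t≢d , t≢p =
      no-DEdges-sharing-a-vertex
        (dEdge r₁∈ d∈₁ p∈₁ q∈₁ x∉₁ c∉₁ p≢d q≢d p≢q)
        (dEdge r₂∈ d∈₂ p∈₂ t∈₂ x∉₂ c∉₂ p≢d t≢d (≢-sym t≢p))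
        (∉∧∈⇒≢ q∉₂ t∈₂)
    DEdges-impossible | r₁ , r₁∈ , d∈₁ ∷ [] , x∉₁ ∷ c∉₁ ∷ [] | p , q , p∈₁ , q∈₁ , p≢d , q≢d , p≢q | no ¬pos
      with 0<#⇒Edge (≤-trans (s≤s z≤n) (#-peel p 1 3≤#d-edges pd≤1))
      where
      pd≤1 : #⟨ p ∷ d ∷ [] ∖ x ∷ c ∷ [] ⟩ ≤ 1
      pd≤1 = ≤-trans (≤-reflexive (#-split q))
               (+-mono-≤ (≤-trans #-drop-avoided (#⟨triple⟩≤1 (≢-sym p≢q) q≢d p≢d)) (≮⇒≥ ¬pos))
    ... | r₂ , r₂∈ , d∈₂ ∷ [] , p∉₂ ∷ x∉₂ ∷ c∉₂ ∷ [] with q ∈? r₂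
    ...   | yes q∈₂ with other-vertex r₂∈ d q
    ...     | t , t∈₂ , t≢d , t≢q =
      no-DEdges-sharing-a-vertex
        (dEdge r₁∈ d∈₁ q∈₁ p∈₁ x∉₁ c∉₁ q≢d p≢d (≢-sym p≢q))
        (dEdge r₂∈ d∈₂ q∈₂ t∈₂ x∉₂ c∉₂ q≢d t≢d (≢-sym t≢q))
        (∉∧∈⇒≢ p∉₂ t∈₂)
    DEdges-impossible | r₁ , r₁∈ , d∈₁ ∷ [] , x∉₁ ∷ c∉₁ ∷ [] | p , q , p∈₁ , q∈₁ , p≢d , q≢d , p≢q | no ¬pos
      | r₂ , r₂∈ , d∈₂ ∷ [] , p∉₂ ∷ x∉₂ ∷ c∉₂ ∷ [] | no q∉₂ with two-other-vertices r₂∈ d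
    ... | p′ , q′ , p′∈₂ , q′∈₂ , p′≢d , q′≢d , p′≢q′ =
      no-disjoint-DEdges
        (dEdge r₁∈ d∈₁ p∈₁ q∈₁ x∉₁ c∉₁ p≢d q≢d p≢q)
        (dEdge r₂∈ d∈₂ p′∈₂ q′∈₂ x∉₂ c∉₂ p′≢d q′≢d p′≢q′)
        p∉₂ q∉₂

  light-impossible : 8 ≤ n → (∀ {w} → x ≢ w → #⟨ x ∷ w ∷ [] ∖ [] ⟩ ≤ 4) → ⊥
  light-impossible n≥8 light with 0<#⇒Edge (≤-trans (s≤s z≤n) (≤-trans (m≤n+m 5 n) (≤-trans (δ x) (≤-reflexive (deg≡# x)))))
  ... | e₀ , e₀∈ , x∈ ∷ [] , [] with two-other-vertices e₀∈ x
  ...   | c , d , c∈ , d∈ , c≢x , d≢x , c≢d =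
    DEdges-impossible n≥8 light (≢-sym c≢x) (≢-sym d≢x) c≢d (e₀ , e₀∈ , x∈ ∷ c∈ ∷ d∈ ∷ [] , [])

  impossible : 8 ≤ n → ⊥
  impossible n≥8 = light-impossible n≥8 λ x≢w → s≤s⁻¹ (≰⇒> (heavy-partner-impossible x≢w))

high-degree⇒¬¬covering : ∀ {n} (G : 3-Graph n) → 8 ≤ n → (∀ v → n + 5 ≤ deg G v) → ¬ ¬ HasP₃Covering G
high-degree⇒¬¬covering G n≥8 δ =
  sequence (RawMonad.rawApplicative ¬¬-Monad) λ x x∉P₃ → MissedVertex.impossible G δ x x∉P₃ n≥8

theorem10 : (n : ℕ) → 8 ≤ n →
    (Σ (3-Graph n) λ G → (¬ HasP₃Covering G) × MinDeg≥ G (n ∸ 2)) ×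
    (∀ (G : 3-Graph n) → ¬ HasP₃Covering G → ∀ d → MinDeg≥ G d → d ≤ n + 4)
theorem10 n@(suc (suc m)) n≥8 = (star (suc m) , star-not-covered , star-min-degree m) , δ₁≤n+4
  where
  δ₁≤n+4 : ∀ (G : 3-Graph n) → ¬ HasP₃Covering G → ∀ d → MinDeg≥ G d → d ≤ n + 4
  δ₁≤n+4 G ¬covering d δ≥d with d ≤? n + 4
  ... | yes d≤n+4 = d≤n+4
  ... | no d≰n+4  = contradiction ¬covering (high-degree⇒¬¬covering G n≥8 λ v →
                      ≤-trans (subst (_≤ d) (sym (+-suc n 4)) (≰⇒> d≰n+4)) (δ≥d v))
theorem10 (suc zero) (s≤s ())
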